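{- Let $n\ge 1$ and $k\ge 0$ be integers. Then $$p^{1}_{n,n+k;\le n+k}=p^{2}_{n,n+k;\le n+k}=\cdots=p^{k+1}_{n,n+k;\le n+k}.$$
   Context: Parking model: there are $m$ parking spaces in a line, numbered $1,\dots,m$ from left to right. A preference set of length $n$ is a sequence $(a_1,\dots,a_n)$ of integers with $1\le a_i\le m$. Cars $1,\dots,n$ arrive in this order; car $i$ goes to space $a_i$ and parks in the first unoccupied space numbered $\ge a_i$ if such a space exists, and otherwise fails to park. A preference set is a $k$-flaw preference set if exactly $k$ cars fail to park; a $0$-flaw preference set is a parking function. $\mathcal{P}_{n,m;\le s;k}$ denotes the set of $k$-flaw preference sets $(a_1,\dots,a_n)$ of length $n$ with $m$ spaces such that $1\le a_i\le s$ for all $i$, and $\mathcal{P}^l_{n,m;\le s;k}$ its subset with $a_1=l$; $p_{n,m;\le s;k}$ and $p^l_{n,m;\le s;k}$ are their cardinalities. If the index $k$ is omitted, $k=0$. So $p^l_{n,n+k;\le n+k}$ is the number of parking functions $(a_1,\dots,a_n)$ with $n+k$ spaces, all $a_i\le n+k$, and $a_1=l$. -}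

module Defs where

open import Data.Nat using (ℕ; zero; suc; _≡ᵇ_)
open import Data.Bool using (Bool; true; false; _∧_; if_then_else_)
open import Data.List using (List; []; _∷_; map; concatMap; length; replicate; upTo)
open import Data.Maybe using (Maybe; just; nothing)

-- Occupancy of the m spaces: a list of m booleans, position j (0-based)
-- is space j+1; true = occupied.

park : ℕ → List Bool → Maybe (List Bool)
park _ [] = nothing
park zero (false ∷ bs) = just (true ∷ bs)
park zero (true ∷ bs) with park zero bs
... | just bs' = just (true ∷ bs')
... | nothing = nothing
park (suc d) (b ∷ bs) with park d bs
... | just bs' = just (b ∷ bs')
... | nothing = nothing

-- number of cars that fail to park, when cars with preferences `as`
-- arrive in order into the current occupancy `occ`.
-- A preference a (1 ≤ a) means: go to space a, i.e. 0-based index a ∸ 1.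
failures : List ℕ → List Bool → ℕ
failures [] occ = 0
failures (a ∷ as) occ with park (a Data.Nat.∸ 1) occ
... | just occ' = failures as occ'
... | nothing = suc (failures as occ)

flaws : ℕ → List ℕ → ℕ
flaws m as = failures as (replicate m false)

prefs : ℕ → ℕ → List (List ℕ)
prefs zero s = [] ∷ []
prefs (suc n) s = concatMap (λ a → map (a ∷_) (prefs n s)) (map suc (upTo s))

count : {A : Set} → (A → Bool) → List A → ℕ
count p [] = 0
count p (x ∷ xs) = if p x then suc (count p xs) else count p xs

firstIs : ℕ → List ℕ → Bool
firstIs l [] = false
firstIs l (a ∷ _) = a ≡ᵇ l

-- p_{n,m;≤s;k} : number of k-flaw preference sets of length n, m spaces, entries ≤ s
p : ℕ → ℕ → ℕ → ℕ → ℕ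
p n m s k = count (λ as → flaws m as ≡ᵇ k) (prefs n s)

pFirst : ℕ → ℕ → ℕ → ℕ → ℕ → ℕ
pFirst l n m s k = count (λ as → firstIs l as ∧ (flaws m as ≡ᵇ k)) (prefs n s)

-- A list of cars parks completely into a partially occupied lot iff a Hall-type
-- condition holds: for every j, the cars still to come that prefer a space of index
-- ≥ j, together with the spaces of index ≥ j already occupied, number at most the
-- spaces of index ≥ j.  In an empty lot of n + k spaces this condition is automatic
-- for j ≤ k, since there are n + k − j ≥ n spaces there; so for a first preference
-- l ≤ k + 1, whether (l, a₂, …, aₙ) is a parking function does not depend on l, and
-- the sets counted by p^l and p^1 correspond tail by tail.
module Submission where

open import Defs
open import Data.Nat using (ℕ; _+_; _≤_)
open import Relation.Binary.PropositionalEquality using (_≡_)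

open import Data.Bool using (Bool; true; false; T; _∧_)
open import Data.Empty using (⊥-elim)
open import Function using (id)
open import Data.List using (List; []; _∷_; _++_; map; concatMap; length; replicate; upTo)
open import Data.List.Properties using (length-replicate; map-upTo)
open import Data.List.Relation.Unary.All as All using (All; []; _∷_)
open import Data.List.Relation.Unary.All.Properties using (concat⁺; map⁺)
open import Data.Maybe using (just; nothing)
open import Data.Nat using (zero; suc; _∸_; _<_; _*_; _≡ᵇ_; z≤n; s≤s; _≤?_)
open import Data.Nat.Properties
open import Data.Product using (_×_; _,_)
open import Data.Sum using (_⊎_; inj₁; inj₂)
open import Relation.Nullary using (¬_; Dec; yes; no)
open import Relation.Binary.PropositionalEquality
  using (refl; sym; trans; cong; cong₂; subst; module ≡-Reasoning)

occupiedFrom : List Bool → ℕ → ℕ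
occupiedFrom []          _       = 0
occupiedFrom (_ ∷ o)     (suc j) = occupiedFrom o j
occupiedFrom (true ∷ o)  zero    = suc (occupiedFrom o zero)
occupiedFrom (false ∷ o) zero    = occupiedFrom o zero

demandFrom : List ℕ → ℕ → ℕ
demandFrom []       j = 0
demandFrom (a ∷ as) j with j ≤? a ∸ 1
... | yes _ = suc (demandFrom as j)
... | no  _ = demandFrom as j

Fits : List ℕ → List Bool → Set
Fits as o = ∀ j → demandFrom as j + occupiedFrom o j ≤ length o ∸ j

occupiedFrom≤ : ∀ o j → occupiedFrom o j ≤ length o ∸ j
occupiedFrom≤ []          j       = z≤n
occupiedFrom≤ (true ∷ o)  zero    = s≤s (occupiedFrom≤ o zero)
occupiedFrom≤ (false ∷ o) zero    = m≤n⇒m≤1+n (occupiedFrom≤ o zero)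
occupiedFrom≤ (_ ∷ o)     (suc j) = occupiedFrom≤ o j

occupiedFrom-replicate-false : ∀ m j → occupiedFrom (replicate m false) j ≡ 0
occupiedFrom-replicate-false zero    j       = refl
occupiedFrom-replicate-false (suc m) zero    = occupiedFrom-replicate-false m zero
occupiedFrom-replicate-false (suc m) (suc j) = occupiedFrom-replicate-false m j

demandFrom-≤ : ∀ a as {j} → j ≤ a ∸ 1 → demandFrom (a ∷ as) j ≡ suc (demandFrom as j)
demandFrom-≤ a as {j} j≤d with j ≤? a ∸ 1
... | yes _   = refl
... | no  j≰d = ⊥-elim (j≰d j≤d)

demandFrom-≰ : ∀ a as {j} → ¬ j ≤ a ∸ 1 → demandFrom (a ∷ as) j ≡ demandFrom as j
demandFrom-≰ a as {j} j≰d with j ≤? a ∸ 1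
... | yes j≤d = ⊥-elim (j≰d j≤d)
... | no  _   = refl

demandFrom-antimono : ∀ as {i j} → i ≤ j → demandFrom as j ≤ demandFrom as i
demandFrom-antimono []       i≤j = z≤n
demandFrom-antimono (a ∷ as) {i} {j} i≤j with j ≤? a ∸ 1 | i ≤? a ∸ 1
... | yes _   | yes _   = s≤s (demandFrom-antimono as i≤j)
... | yes j≤d | no  i≰d = ⊥-elim (i≰d (≤-trans i≤j j≤d))
... | no  _   | yes _   = m≤n⇒m≤1+n (demandFrom-antimono as i≤j)
... | no  _   | no  _   = demandFrom-antimono as i≤j

demandFrom≤length : ∀ as j → demandFrom as j ≤ length as
demandFrom≤length []       j = z≤n
demandFrom≤length (a ∷ as) j with j ≤? a ∸ 1
... | yes _ = s≤s (demandFrom≤length as j)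
... | no  _ = m≤n⇒m≤1+n (demandFrom≤length as j)

park-full : ∀ d o → park d o ≡ nothing → occupiedFrom o d ≡ length o ∸ d
park-full d       []          _ = sym (0∸n≡0 d)
park-full zero    (false ∷ o) ()
park-full zero    (true ∷ o)  e with park zero o in eq
... | nothing = cong suc (park-full zero o eq)
park-full zero    (true ∷ o)  () | just _
park-full (suc d) (b ∷ o)     e with park d o in eq
... | nothing = park-full d o eq
park-full (suc d) (b ∷ o)     () | just _

park-length : ∀ d o {o'} → park d o ≡ just o' → length o' ≡ length o
park-length d       []          ()
park-length zero    (false ∷ o) refl = refl
park-length zero    (true ∷ o)  e with park zero o in eq
park-length zero    (true ∷ o)  refl | just _ = cong suc (park-length zero o eq)
park-length zero    (true ∷ o)  ()   | nothing
park-length (suc d) (b ∷ o)     e with park d o in eq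
park-length (suc d) (b ∷ o)     refl | just _ = cong suc (park-length d o eq)
park-length (suc d) (b ∷ o)     ()   | nothing

park-occupiedFrom-≤ : ∀ d o {o'} → park d o ≡ just o' →
  ∀ {j} → j ≤ d → occupiedFrom o' j ≡ suc (occupiedFrom o j)
park-occupiedFrom-≤ d       []          ()
park-occupiedFrom-≤ zero    (false ∷ o) refl z≤n = refl
park-occupiedFrom-≤ zero    (true ∷ o)  e j≤d with park zero o in eq
park-occupiedFrom-≤ zero    (true ∷ o)  refl z≤n | just _ = cong suc (park-occupiedFrom-≤ zero o eq z≤n)
park-occupiedFrom-≤ zero    (true ∷ o)  ()   _   | nothing
park-occupiedFrom-≤ (suc d) (b ∷ o)     e j≤d with park d o in eq
park-occupiedFrom-≤ (suc d) (true ∷ o)  refl z≤n | just _ = cong suc (park-occupiedFrom-≤ d o eq z≤n)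
park-occupiedFrom-≤ (suc d) (false ∷ o) refl z≤n | just _ = park-occupiedFrom-≤ d o eq z≤n
park-occupiedFrom-≤ (suc d) (b ∷ o)     refl (s≤s j≤d) | just _ = park-occupiedFrom-≤ d o eq j≤d
park-occupiedFrom-≤ (suc d) (b ∷ o)     ()   _   | nothing

-- If the count at j ≥ d grows, the car parked at or beyond j, so all of d, …, j−1 were occupied.
park-occupiedFrom-≥ : ∀ d o {o'} → park d o ≡ just o' → ∀ {j} → d ≤ j →
  occupiedFrom o' j ≡ occupiedFrom o j
  ⊎ (occupiedFrom o' j ≡ suc (occupiedFrom o j) × occupiedFrom o d ≡ (j ∸ d) + occupiedFrom o j)
park-occupiedFrom-≥ d       []          ()
park-occupiedFrom-≥ zero    (false ∷ o) refl {zero}  _ = inj₂ (refl , refl)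
park-occupiedFrom-≥ zero    (false ∷ o) refl {suc j} _ = inj₁ refl
park-occupiedFrom-≥ zero    (true ∷ o)  e _ with park zero o in eq
park-occupiedFrom-≥ zero    (true ∷ o)  refl {zero} _ | just _ =
  inj₂ (cong suc (park-occupiedFrom-≤ zero o eq z≤n) , refl)
park-occupiedFrom-≥ zero    (true ∷ o)  refl {suc j} _ | just _
  with park-occupiedFrom-≥ zero o eq {j} z≤n
... | inj₁ same          = inj₁ same
... | inj₂ (grew , full) = inj₂ (grew , cong suc full)
park-occupiedFrom-≥ zero    (true ∷ o)  () _ | nothing
park-occupiedFrom-≥ (suc d) (b ∷ o)     e _ with park d o in eq
park-occupiedFrom-≥ (suc d) (b ∷ o)     refl (s≤s d≤j) | just _ = park-occupiedFrom-≥ d o eq d≤j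
park-occupiedFrom-≥ (suc d) (b ∷ o)     () _ | nothing

demand-occupied-park-≤ : ∀ a as o {o'} → park (a ∸ 1) o ≡ just o' → ∀ {j} → j ≤ a ∸ 1 →
  demandFrom (a ∷ as) j + occupiedFrom o j ≡ demandFrom as j + occupiedFrom o' j
demand-occupied-park-≤ a as o {o'} eq {j} j≤d = begin
  demandFrom (a ∷ as) j + occupiedFrom o j   ≡⟨ cong (_+ occupiedFrom o j) (demandFrom-≤ a as j≤d) ⟩
  suc (demandFrom as j) + occupiedFrom o j   ≡⟨ sym (+-suc (demandFrom as j) (occupiedFrom o j)) ⟩
  demandFrom as j + suc (occupiedFrom o j)   ≡⟨ cong (demandFrom as j +_) (sym (park-occupiedFrom-≤ (a ∸ 1) o eq j≤d)) ⟩
  demandFrom as j + occupiedFrom o' j        ∎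
  where open ≡-Reasoning

park-occupiedFrom-mono : ∀ d o {o'} → park d o ≡ just o' → ∀ j → occupiedFrom o j ≤ occupiedFrom o' j
park-occupiedFrom-mono d o eq j with j ≤? d
... | yes j≤d = ≤-trans (n≤1+n _) (≤-reflexive (sym (park-occupiedFrom-≤ d o eq j≤d)))
... | no  j≰d with park-occupiedFrom-≥ d o eq (<⇒≤ (≰⇒> j≰d))
...   | inj₁ same       = ≤-reflexive (sym same)
...   | inj₂ (grew , _) = ≤-trans (n≤1+n _) (≤-reflexive (sym grew))

Fits-unpark : ∀ a as o {o'} → park (a ∸ 1) o ≡ just o' → Fits as o' → Fits (a ∷ as) o
Fits-unpark a as o {o'} eq fits j = begin
  demandFrom (a ∷ as) j + occupiedFrom o j  ≤⟨ step (j ≤? a ∸ 1) ⟩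
  demandFrom as j + occupiedFrom o' j       ≤⟨ fits j ⟩
  length o' ∸ j                             ≡⟨ cong (_∸ j) (park-length (a ∸ 1) o eq) ⟩
  length o ∸ j                              ∎
  where
  open ≤-Reasoning
  step : Dec (j ≤ a ∸ 1) → demandFrom (a ∷ as) j + occupiedFrom o j ≤ demandFrom as j + occupiedFrom o' j
  step (yes j≤d) = ≤-reflexive (demand-occupied-park-≤ a as o eq j≤d)
  step (no  j≰d) rewrite demandFrom-≰ a as j≰d =
    +-monoʳ-≤ (demandFrom as j) (park-occupiedFrom-mono (a ∸ 1) o eq j)

m+[n∸o]≤p∸o⇒m≤p∸n : ∀ m {n o p} → o ≤ n → m + (n ∸ o) ≤ p ∸ o → m ≤ p ∸ n
m+[n∸o]≤p∸o⇒m≤p∸n m {n} {o} {p} o≤n le =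
  subst (m ≤_) (trans (∸-+-assoc p o (n ∸ o)) (cong (p ∸_) (m+[n∸m]≡n o≤n))) (m+n≤o⇒m≤o∸n m le)

Fits-park : ∀ a as o {o'} → park (a ∸ 1) o ≡ just o' → Fits (a ∷ as) o → Fits as o'
Fits-park a as o {o'} eq fits j rewrite park-length (a ∸ 1) o eq = bound (j ≤? d)
  where
  d = a ∸ 1
  open ≤-Reasoning
  bound : Dec (j ≤ d) → demandFrom as j + occupiedFrom o' j ≤ length o ∸ j
  bound (yes j≤d) = begin
    demandFrom as j + occupiedFrom o' j        ≡⟨ sym (demand-occupied-park-≤ a as o eq j≤d) ⟩
    demandFrom (a ∷ as) j + occupiedFrom o j   ≤⟨ fits j ⟩
    length o ∸ j                               ∎
  bound (no j≰d) with <⇒≤ (≰⇒> j≰d)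
  ... | d≤j with park-occupiedFrom-≥ d o eq d≤j
  ...   | inj₁ same = begin
    demandFrom as j + occupiedFrom o' j        ≡⟨ cong₂ _+_ (sym (demandFrom-≰ a as j≰d)) same ⟩
    demandFrom (a ∷ as) j + occupiedFrom o j   ≤⟨ fits j ⟩
    length o ∸ j                               ∎
  -- spaces d, …, j−1 are all occupied, so Hall's condition at d covers j
  ...   | inj₂ (grew , full) = m+[n∸o]≤p∸o⇒m≤p∸n _ d≤j (begin
    demandFrom as j + occupiedFrom o' j + (j ∸ d)        ≡⟨ cong (λ x → demandFrom as j + x + (j ∸ d)) grew ⟩
    demandFrom as j + suc (occupiedFrom o j) + (j ∸ d)   ≡⟨ cong (_+ (j ∸ d)) (+-suc (demandFrom as j) _) ⟩
    suc (demandFrom as j) + occupiedFrom o j + (j ∸ d)   ≡⟨ +-assoc (suc (demandFrom as j)) _ _ ⟩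
    suc (demandFrom as j) + (occupiedFrom o j + (j ∸ d)) ≡⟨ cong (suc (demandFrom as j) +_) (trans (+-comm _ (j ∸ d)) (sym full)) ⟩
    suc (demandFrom as j) + occupiedFrom o d             ≤⟨ +-monoˡ-≤ _ (s≤s (demandFrom-antimono as d≤j)) ⟩
    suc (demandFrom as d) + occupiedFrom o d             ≡⟨ cong (_+ occupiedFrom o d) (sym (demandFrom-≤ a as ≤-refl)) ⟩
    demandFrom (a ∷ as) d + occupiedFrom o d             ≤⟨ fits d ⟩
    length o ∸ d                                         ∎)

Fits-park-nothing : ∀ a as o → park (a ∸ 1) o ≡ nothing → ¬ Fits (a ∷ as) o
Fits-park-nothing a as o eq fits = <-irrefl refl (begin-strict
  length o ∸ d                               <⟨ s≤s (m≤n+m _ (demandFrom as d)) ⟩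
  suc (demandFrom as d) + (length o ∸ d)     ≡⟨ cong₂ _+_ (sym (demandFrom-≤ a as ≤-refl)) (sym (park-full d o eq)) ⟩
  demandFrom (a ∷ as) d + occupiedFrom o d   ≤⟨ fits d ⟩
  length o ∸ d                               ∎)
  where
  d = a ∸ 1
  open ≤-Reasoning

failures≡0⇒Fits : ∀ as o → failures as o ≡ 0 → Fits as o
failures≡0⇒Fits []       o _ = occupiedFrom≤ o
failures≡0⇒Fits (a ∷ as) o e with park (a ∸ 1) o in eq
... | just o' = Fits-unpark a as o eq (failures≡0⇒Fits as o' e)
failures≡0⇒Fits (a ∷ as) o () | nothing

Fits⇒failures≡0 : ∀ as o → Fits as o → failures as o ≡ 0
Fits⇒failures≡0 []       o _ = refl
Fits⇒failures≡0 (a ∷ as) o fits with park (a ∸ 1) o in eq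
... | just o' = Fits⇒failures≡0 as o' (Fits-park a as o eq fits)
... | nothing = ⊥-elim (Fits-park-nothing a as o eq fits)

Fits-replicate-false : ∀ m as j →
  (demandFrom as j + occupiedFrom (replicate m false) j ≤ length (replicate m false) ∸ j)
  ≡ (demandFrom as j ≤ m ∸ j)
Fits-replicate-false m as j
  rewrite occupiedFrom-replicate-false m j | +-identityʳ (demandFrom as j) | length-replicate m {false}
  = refl

flaws≡0⇒demandFrom≤ : ∀ m as → flaws m as ≡ 0 → ∀ j → demandFrom as j ≤ m ∸ j
flaws≡0⇒demandFrom≤ m as e j = subst id (Fits-replicate-false m as j) (failures≡0⇒Fits as _ e j)

demandFrom≤⇒flaws≡0 : ∀ m as → (∀ j → demandFrom as j ≤ m ∸ j) → flaws m as ≡ 0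
demandFrom≤⇒flaws≡0 m as bound =
  Fits⇒failures≡0 as _ (λ j → subst id (sym (Fits-replicate-false m as j)) (bound j))

demandFrom≤-swap-head : ∀ n k a b t → length t ≡ n → a ∸ 1 ≤ k → b ∸ 1 ≤ k →
  (∀ j → demandFrom (a ∷ t) j ≤ suc n + k ∸ j) → ∀ j → demandFrom (b ∷ t) j ≤ suc n + k ∸ j
demandFrom≤-swap-head n k a b t len a≤k b≤k bound j with j ≤? k
... | yes j≤k = begin
  demandFrom (b ∷ t) j   ≤⟨ demandFrom≤length (b ∷ t) j ⟩
  suc (length t)         ≡⟨ cong suc len ⟩
  suc n                  ≤⟨ m≤m+n (suc n) (k ∸ j) ⟩
  suc n + (k ∸ j)        ≡⟨ sym (+-∸-assoc (suc n) j≤k) ⟩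
  suc n + k ∸ j          ∎
  where open ≤-Reasoning
... | no j≰k = begin
  demandFrom (b ∷ t) j   ≡⟨ demandFrom-≰ b t (λ j≤b → j≰k (≤-trans j≤b b≤k)) ⟩
  demandFrom t j         ≡⟨ sym (demandFrom-≰ a t (λ j≤a → j≰k (≤-trans j≤a a≤k))) ⟩
  demandFrom (a ∷ t) j   ≤⟨ bound j ⟩
  suc n + k ∸ j          ∎
  where open ≤-Reasoning

flaws≡0-swap-head : ∀ n k a b t → length t ≡ n → a ∸ 1 ≤ k → b ∸ 1 ≤ k →
  flaws (suc n + k) (a ∷ t) ≡ 0 → flaws (suc n + k) (b ∷ t) ≡ 0
flaws≡0-swap-head n k a b t len a≤k b≤k e =
  demandFrom≤⇒flaws≡0 _ (b ∷ t)
    (demandFrom≤-swap-head n k a b t len a≤k b≤k (flaws≡0⇒demandFrom≤ _ (a ∷ t) e))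

≡ᵇ0-cong : ∀ {m n} → (m ≡ 0 → n ≡ 0) → (n ≡ 0 → m ≡ 0) → (m ≡ᵇ 0) ≡ (n ≡ᵇ 0)
≡ᵇ0-cong {zero}  {zero}  _ _ = refl
≡ᵇ0-cong {zero}  {suc n} f _ with () ← f refl
≡ᵇ0-cong {suc m} {zero}  _ g with () ← g refl
≡ᵇ0-cong {suc m} {suc n} _ _ = refl

module _ {A : Set} where

  count-++ : ∀ (f : A → Bool) xs ys → count f (xs ++ ys) ≡ count f xs + count f ys
  count-++ f []       ys = refl
  count-++ f (x ∷ xs) ys with f x
  ... | true  = cong suc (count-++ f xs ys)
  ... | false = count-++ f xs ys

  count-const-false : ∀ (xs : List A) → count (λ _ → false) xs ≡ 0
  count-const-false []       = refl
  count-const-false (_ ∷ xs) = count-const-false xs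

  count-cong-All : ∀ {P : A → Set} {f g : A → Bool} → (∀ x → P x → f x ≡ g x) →
    ∀ {xs} → All P xs → count f xs ≡ count g xs
  count-cong-All {f = f} {g} f≗g {x ∷ xs} (px ∷ pxs) with f x | g x | f≗g x px
  ... | true  | true  | refl = cong suc (count-cong-All f≗g pxs)
  ... | false | false | refl = count-cong-All f≗g pxs
  count-cong-All f≗g [] = refl

  count-map : ∀ {B : Set} (f : B → Bool) (g : A → B) xs → count f (map g xs) ≡ count (λ x → f (g x)) xs
  count-map f g []       = refl
  count-map f g (x ∷ xs) with f (g x)
  ... | true  = cong suc (count-map f g xs)
  ... | false = count-map f g xs

count-firstIs-concatMap : ∀ l (q : List ℕ → Bool) (P : List (List ℕ)) L →
  count (λ as → firstIs l as ∧ q as) (concatMap (λ a → map (a ∷_) P) L)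
  ≡ count (_≡ᵇ l) L * count (λ t → q (l ∷ t)) P
count-firstIs-concatMap l q P []       = refl
count-firstIs-concatMap l q P (a ∷ L) = begin
  count F (map (a ∷_) P ++ concatMap block L)                   ≡⟨ count-++ F (map (a ∷_) P) _ ⟩
  count F (map (a ∷_) P) + count F (concatMap block L)          ≡⟨ cong₂ _+_ (count-map F (a ∷_) P) (count-firstIs-concatMap l q P L) ⟩
  count (λ t → (a ≡ᵇ l) ∧ q (a ∷ t)) P + count (_≡ᵇ l) L * C    ≡⟨ head-block ⟩
  count (_≡ᵇ l) (a ∷ L) * C                                     ∎
  where
  open ≡-Reasoning
  F = λ as → firstIs l as ∧ q as
  block = λ a → map (a ∷_) P
  C = count (λ t → q (l ∷ t)) P
  head-block : count (λ t → (a ≡ᵇ l) ∧ q (a ∷ t)) P + count (_≡ᵇ l) L * C ≡ count (_≡ᵇ l) (a ∷ L) * C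
  head-block with a ≡ᵇ l in eq
  ... | true with refl ← ≡ᵇ⇒≡ a l (subst T (sym eq) _) = refl
  ... | false = cong (_+ count (_≡ᵇ l) L * C) (count-const-false P)

upTo-suc : ∀ s → upTo (suc s) ≡ 0 ∷ map suc (upTo s)
upTo-suc s = cong (0 ∷_) (sym (map-upTo suc s))

count-≡ᵇ-upTo : ∀ {l s} → l < s → count (_≡ᵇ l) (upTo s) ≡ 1
count-≡ᵇ-upTo {zero}  {suc s} _ = begin
  count (_≡ᵇ 0) (upTo (suc s))              ≡⟨ cong (count (_≡ᵇ 0)) (upTo-suc s) ⟩
  suc (count (_≡ᵇ 0) (map suc (upTo s)))    ≡⟨ cong suc (count-map (_≡ᵇ 0) suc (upTo s)) ⟩
  suc (count (λ _ → false) (upTo s))        ≡⟨ cong suc (count-const-false (upTo s)) ⟩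
  1                                         ∎
  where open ≡-Reasoning
count-≡ᵇ-upTo {suc l} {suc s} (s≤s l<s) = begin
  count (_≡ᵇ suc l) (upTo (suc s))          ≡⟨ cong (count (_≡ᵇ suc l)) (upTo-suc s) ⟩
  count (_≡ᵇ suc l) (map suc (upTo s))      ≡⟨ count-map (_≡ᵇ suc l) suc (upTo s) ⟩
  count (_≡ᵇ l) (upTo s)                    ≡⟨ count-≡ᵇ-upTo l<s ⟩
  1                                         ∎
  where open ≡-Reasoning

prefs-length : ∀ n s → All (λ t → length t ≡ n) (prefs n s)
prefs-length zero    s = refl ∷ []
prefs-length (suc n) s =
  concat⁺ (map⁺ (All.universal (λ _ → map⁺ (All.map (cong suc) (prefs-length n s))) (map suc (upTo s))))

pFirst-suc : ∀ {l} n m s k → 1 ≤ l → l ≤ s →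
  pFirst l (suc n) m s k ≡ count (λ t → flaws m (l ∷ t) ≡ᵇ k) (prefs n s)
pFirst-suc {suc l} n m s k _ l<s = begin
  pFirst (suc l) (suc n) m s k                 ≡⟨ count-firstIs-concatMap (suc l) _ (prefs n s) (map suc (upTo s)) ⟩
  count (_≡ᵇ suc l) (map suc (upTo s)) * C     ≡⟨ cong (_* C) (trans (count-map (_≡ᵇ suc l) suc (upTo s)) (count-≡ᵇ-upTo l<s)) ⟩
  1 * C                                        ≡⟨ *-identityˡ C ⟩
  C                                            ∎
  where
  open ≡-Reasoning
  C = count (λ t → flaws m (suc l ∷ t) ≡ᵇ k) (prefs n s)

theorem4p1 : (n k : ℕ) → 1 ≤ n → (l : ℕ) → 1 ≤ l → l ≤ k + 1 →
    pFirst l n (n + k) (n + k) 0 ≡ pFirst 1 n (n + k) (n + k) 0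
theorem4p1 (suc n) k _ l 1≤l l≤k+1 = begin
  pFirst l (suc n) m m 0                           ≡⟨ pFirst-suc n m m 0 1≤l l≤m ⟩
  count (λ t → flaws m (l ∷ t) ≡ᵇ 0) (prefs n m)   ≡⟨ count-cong-All same-flawless (prefs-length n m) ⟩
  count (λ t → flaws m (1 ∷ t) ≡ᵇ 0) (prefs n m)   ≡⟨ sym (pFirst-suc n m m 0 ≤-refl (s≤s z≤n)) ⟩
  pFirst 1 (suc n) m m 0                           ∎
  where
  open ≡-Reasoning
  m = suc n + k
  l≤m : l ≤ m
  l≤m = ≤-trans l≤k+1 (≤-trans (≤-reflexive (+-comm k 1)) (s≤s (m≤n+m k n)))
  l∸1≤k : l ∸ 1 ≤ k
  l∸1≤k = m≤n+o⇒m∸n≤o l 1 (subst (l ≤_) (+-comm k 1) l≤k+1)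
  same-flawless : ∀ t → length t ≡ n → (flaws m (l ∷ t) ≡ᵇ 0) ≡ (flaws m (1 ∷ t) ≡ᵇ 0)
  same-flawless t len =
    ≡ᵇ0-cong (flaws≡0-swap-head n k l 1 t len l∸1≤k z≤n) (flaws≡0-swap-head n k 1 l t len z≤n l∸1≤k)
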